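{- The permutahedron $\mathcal{P}^{\mathrm{adj}}_n$ admits a $2$-rainbow cycle for every $n\ge 5$, and a $3$-rainbow cycle for every odd $n\ge 3$.
   Context: $S_n$ is the set of permutations of $[n]$ in one-line notation. The permutahedron $\mathcal{P}^{\mathrm{adj}}_n$ is the graph on $S_n$ in which two permutations are adjacent iff one is obtained from the other by an adjacent transposition $(i,i+1)$, $i\in[n-1]$, i.e. by swapping the entries in positions $i$ and $i+1$; the edge is colored by $(i,i+1)$. An $r$-rainbow cycle is a cyclic sequence of pairwise distinct permutations, consecutive ones (including last and first) adjacent, in which each of the $n-1$ adjacent transpositions is used in exactly $r$ steps. -}

module Defs where

open import Data.Nat using (ℕ; zero; suc; _*_; _≤_; _∸_)
open import Data.Fin using (Fin; zero; suc; _≟_)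
open import Data.Vec using (Vec; []; _∷_; lookup; tabulate; count)
open import Data.Vec.Relation.Unary.Unique.Propositional using (Unique)
open import Data.Product using (Σ; _×_; _,_)
open import Function using (Injective)
open import Relation.Binary.PropositionalEquality using (_≡_)

-- A permutation of [n] in one-line notation: a length-n word over Fin n
-- with pairwise distinct entries (hence a bijection [n] → [n]).
Perm : ℕ → Set
Perm n = Σ (Vec (Fin n) n) Unique

-- Swap the entries in positions i and i+1 (0-based: i ∈ Fin m with m+1
-- entries, i.e. the adjacent transposition (i+1, i+2) in 1-based terms).
swapAdjVec : ∀ {A : Set} {m} → Fin m → Vec A (suc m) → Vec A (suc m)
swapAdjVec zero    (x ∷ y ∷ xs) = y ∷ x ∷ xs
swapAdjVec (suc i) (x ∷ xs)     = x ∷ swapAdjVec i xs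

AdjBy : ∀ {m} → Fin m → Perm (suc m) → Perm (suc m) → Set
AdjBy i (u , _) (v , _) = v ≡ swapAdjVec i u

open import Data.Maybe using (Maybe; just; nothing)

succ? : ∀ {L} → Fin L → Maybe (Fin L)
succ? {suc zero}    zero    = nothing
succ? {suc (suc L)} zero    = just (suc zero)
succ? {suc (suc L)} (suc k) with succ? {suc L} k
... | just k' = just (suc k')
... | nothing = nothing

next : ∀ {L} → Fin L → Fin L
next {suc L} k with succ? k
... | just k' = k'
... | nothing = zero

record RainbowCycle (r m : ℕ) : Set where
  field
    L        : ℕ
    perm     : Fin L → Perm (suc m)
    colour   : Fin L → Fin m
    distinct : Injective _≡_ _≡_ perm
    steps    : ∀ k → AdjBy (colour k) (perm k) (perm (next k))
    rainbow  : ∀ (i : Fin m) → count (λ k → colour k ≟ i) (tabulate {n = L} (λ k → k)) ≡ r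

HasRainbowCycle : ℕ → ℕ → Set
HasRainbowCycle r zero    = RainbowCycle r zero   -- n = 0 not used
HasRainbowCycle r (suc m) = RainbowCycle r m

{-# OPTIONS --safe #-}
-- Both families grow from a cycle found by hand: one in P^adj_5 for r = 2 and
-- the hexagon P^adj_3 for r = 3. Putting j new smallest entries (j = 1 for
-- r = 2, j = 2 for r = 3) in front of every permutation of an r-rainbow cycle
-- keeps it a cycle, shifts every old transposition by j and leaves the new
-- ones s₁, …, s_j unused. Now take an edge of the cycle whose transposition d
-- does not move the first old entry, and replace its lift by the detour
-- s₁ d s₁ (r = 2) or s₁ s₂ s₁ d s₂ s₁ s₂ (r = 3); it ends at the right vertex
-- because d commutes with the s_i. No inner vertex of the detour begins with
-- the new entries in order, so the detour avoids the lifted cycle, and it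
-- uses each new transposition exactly r times and d once. The new cycle again
-- has an edge fixing the first entry, so the step can be repeated.
module Submission where

open import Defs
open import Data.Nat using (ℕ; zero; suc; _+_; _*_; _≤_; z≤n; s≤s)
open import Data.Nat.Properties using (+-identityʳ; +-comm; +-assoc; *-comm)
open import Data.Bool using (true; false; if_then_else_)
open import Data.Fin using (Fin; zero; suc; _≟_; fromℕ; inject₁; #_)
open import Data.Fin.Properties using (suc-injective)
open import Data.Fin.Relation.Unary.Top using (view; ‵fromℕ; ‵inject₁)
open import Data.Maybe using (just; nothing)
open import Data.Product using (_×_; _,_; proj₁)
open import Data.Vec using (Vec; []; _∷_; _++_; [_]; tail; map; lookup; count; allFin)
open import Data.Vec.Properties using (∷-injectiveˡ; ∷-injectiveʳ; map-++; map-lookup-allFin; ≡-dec)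
open import Data.Vec.Relation.Unary.All as All using (All; []; _∷_; universal)
open import Data.Vec.Relation.Unary.All.Properties using (lookup⁺; map⁺)
open import Data.Vec.Relation.Unary.AllPairs using (allPairs?)
import Data.Vec.Relation.Unary.AllPairs.Properties as AllPairs
open import Data.Vec.Relation.Unary.Unique.Propositional using (Unique; []; _∷_)
import Data.Vec.Relation.Unary.Unique.Propositional.Properties as Unique
open import Function using (_∘_; id; Injective; mk⇔)
open import Relation.Nullary using (¬_; Dec; does; ¬?)
open import Relation.Nullary.Decidable using (dec-false; does-⇔; from-yes)
open import Relation.Unary using (Decidable)
open import Relation.Binary.Definitions using (DecidableEquality)
open import Relation.Binary.PropositionalEquality
  using (_≡_; _≢_; refl; sym; trans; cong; cong₂; subst; ≢-sym; module ≡-Reasoning)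

open ≡-Reasoning

private
  variable
    A B : Set
    k l m n p r : ℕ

map-injective : {f : A → B} → Injective _≡_ _≡_ f → Injective _≡_ _≡_ (map {n = n} f)
map-injective f-inj {[]}     {[]}     _  = refl
map-injective f-inj {x ∷ xs} {y ∷ ys} eq =
  cong₂ _∷_ (f-inj (∷-injectiveˡ eq)) (map-injective f-inj (∷-injectiveʳ eq))

Unique-rotate : {x : A} {xs : Vec A n} → Unique (x ∷ xs) → Unique (xs ++ [ x ])
Unique-rotate (x∉xs ∷ u) = AllPairs.++⁺ u ([] ∷ []) (All.map (λ x≢y → ≢-sym x≢y ∷ []) x∉xs)

Unique-++-map : {Λ : B → A} {D : Vec A n} {R : Vec B p} → Injective _≡_ _≡_ Λ →
                Unique D → Unique R → All (λ v → ∀ z → v ≢ Λ z) D → Unique (D ++ map Λ R)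
Unique-++-map Λ-injective uD uR outside =
  AllPairs.++⁺ uD (Unique.map⁺ Λ-injective uR) (All.map (λ v∉ → map⁺ (universal v∉ _)) outside)

unique? : DecidableEquality A → (xs : Vec A n) → Dec (Unique xs)
unique? _≟ₐ_ = allPairs? (λ x y → ¬? (x ≟ₐ y))

module _ {P : A → Set} (P? : Decidable P) where

  count-++ : (xs : Vec A n) (ys : Vec A p) → count P? (xs ++ ys) ≡ count P? xs + count P? ys
  count-++ []       ys = refl
  count-++ (x ∷ xs) ys with does (P? x)
  ... | true  = cong suc (count-++ xs ys)
  ... | false = count-++ xs ys

  count-map : (f : B → A) (xs : Vec B n) → count P? (map f xs) ≡ count (P? ∘ f) xs
  count-map f []       = refl
  count-map f (x ∷ xs) = cong (if does (P? (f x)) then suc else id) (count-map f xs)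

  count-none : (∀ x → ¬ P x) → (xs : Vec A n) → count P? xs ≡ 0
  count-none ¬P []       = refl
  count-none ¬P (x ∷ xs) rewrite dec-false (P? x) (¬P x) = count-none ¬P xs

  count-cong : {Q : A → Set} (Q? : Decidable Q) → (∀ x → does (P? x) ≡ does (Q? x)) →
               (xs : Vec A n) → count P? xs ≡ count Q? xs
  count-cong Q? same []       = refl
  count-cong Q? same (x ∷ xs) = cong₂ (λ b → if b then suc else id) (same x) (count-cong Q? same xs)

count-map-injective : {σ : Fin k → Fin l} → Injective _≡_ _≡_ σ → (j : Fin k) (xs : Vec (Fin k) n) →
                      count (_≟ σ j) (map σ xs) ≡ count (_≟ j) xs
count-map-injective {σ = σ} σ-injective j xs =
  trans (count-map (_≟ σ j) σ xs)
        (count-cong _ (_≟ j) (λ x → does-⇔ (mk⇔ σ-injective (cong σ)) (σ x ≟ σ j) (x ≟ j)) xs)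

count-map-∉ : {σ : Fin k → Fin l} {i : Fin l} → (∀ x → σ x ≢ i) → (xs : Vec (Fin k) n) →
              count (_≟ i) (map σ xs) ≡ 0
count-map-∉ {σ = σ} {i} i∉σ xs = trans (count-map (_≟ i) σ xs) (count-none _ i∉σ xs)

swapAdjVec-map : (f : A → B) (i : Fin k) (x : Vec A (suc k)) →
                 swapAdjVec i (map f x) ≡ map f (swapAdjVec i x)
swapAdjVec-map f zero    (x ∷ y ∷ xs) = refl
swapAdjVec-map f (suc i) (x ∷ xs)     = cong (f x ∷_) (swapAdjVec-map f i xs)

swapAdjVec-All : {P : A → Set} (i : Fin k) {x : Vec A (suc k)} → All P x → All P (swapAdjVec i x)
swapAdjVec-All zero    (px ∷ py ∷ pxs) = py ∷ px ∷ pxs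
swapAdjVec-All (suc i) (px ∷ pxs)      = px ∷ swapAdjVec-All i pxs

swapAdjVec-unique : (i : Fin k) {x : Vec A (suc k)} → Unique x → Unique (swapAdjVec i x)
swapAdjVec-unique zero    ((x≢y ∷ x∉xs) ∷ y∉xs ∷ u) = (≢-sym x≢y ∷ y∉xs) ∷ x∉xs ∷ u
swapAdjVec-unique (suc i) (x∉xs ∷ u)               = swapAdjVec-All i x∉xs ∷ swapAdjVec-unique i u

swapAdjVec-≢ : (i : Fin k) {x : Vec A (suc k)} → Unique x → x ≢ swapAdjVec i x
swapAdjVec-≢ zero    ((x≢y ∷ _) ∷ _) eq = x≢y (∷-injectiveˡ eq)
swapAdjVec-≢ (suc i) (_ ∷ u)         eq = swapAdjVec-≢ i u (∷-injectiveʳ eq)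

applySwaps : Vec A (suc k) → Vec (Fin k) n → Vec A (suc k)
applySwaps x []      = x
applySwaps x (i ∷ w) = applySwaps (swapAdjVec i x) w

-- The final vertex is excluded, so a closed walk is a cycle iff its trace is Unique.
trace : Vec A (suc k) → Vec (Fin k) n → Vec (Vec A (suc k)) n
trace x []      = []
trace x (i ∷ w) = x ∷ trace (swapAdjVec i x) w

applySwaps-++ : (x : Vec A (suc k)) (v : Vec (Fin k) n) (w : Vec (Fin k) p) →
                applySwaps x (v ++ w) ≡ applySwaps (applySwaps x v) w
applySwaps-++ x []      w = refl
applySwaps-++ x (i ∷ v) w = applySwaps-++ (swapAdjVec i x) v w

trace-++ : (x : Vec A (suc k)) (v : Vec (Fin k) n) (w : Vec (Fin k) p) →
           trace x (v ++ w) ≡ trace x v ++ trace (applySwaps x v) w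
trace-++ x []      w = refl
trace-++ x (i ∷ v) w = cong (x ∷_) (trace-++ (swapAdjVec i x) v w)

trace-unique : (x : Vec A (suc k)) (w : Vec (Fin k) n) → Unique x → All Unique (trace x w)
trace-unique x []      u = []
trace-unique x (i ∷ w) u = u ∷ trace-unique (swapAdjVec i x) w (swapAdjVec-unique i u)

succ?-inject₁ : (j : Fin n) → succ? (inject₁ j) ≡ just (suc j)
succ?-inject₁ zero    = refl
succ?-inject₁ (suc j) with succ? (inject₁ j) | succ?-inject₁ j
... | _ | refl = refl

succ?-fromℕ : ∀ n → succ? (fromℕ n) ≡ nothing
succ?-fromℕ zero    = refl
succ?-fromℕ (suc n) with succ? (fromℕ n) | succ?-fromℕ n
... | _ | refl = refl

next-inject₁ : (j : Fin n) → next (inject₁ j) ≡ suc j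
next-inject₁ j with succ? (inject₁ j) | succ?-inject₁ j
... | _ | refl = refl

next-fromℕ : ∀ n → next (fromℕ n) ≡ zero
next-fromℕ n with succ? (fromℕ n) | succ?-fromℕ n
... | _ | refl = refl

lookup-trace-suc : (x : Vec A (suc k)) (w : Vec (Fin k) (suc n)) (j : Fin n) →
                   lookup (trace x w) (suc j) ≡
                   swapAdjVec (lookup w (inject₁ j)) (lookup (trace x w) (inject₁ j))
lookup-trace-suc x (i ∷ _ ∷ _) zero    = refl
lookup-trace-suc x (i ∷ w)     (suc j) = lookup-trace-suc (swapAdjVec i x) w j

lookup-trace-last : (x : Vec A (suc k)) (w : Vec (Fin k) (suc n)) →
                    swapAdjVec (lookup w (fromℕ n)) (lookup (trace x w) (fromℕ n)) ≡ applySwaps x w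
lookup-trace-last x (i ∷ [])        = refl
lookup-trace-last x (i ∷ w@(_ ∷ _)) = lookup-trace-last (swapAdjVec i x) w

lookup-trace-next : (x : Vec A (suc k)) (w : Vec (Fin k) n) → applySwaps x w ≡ x → ∀ j →
                    lookup (trace x w) (next j) ≡ swapAdjVec (lookup w j) (lookup (trace x w) j)
lookup-trace-next {n = suc n} x w@(_ ∷ _) closed j with view j
... | ‵fromℕ      = begin
  lookup (trace x w) (next (fromℕ n))                          ≡⟨ cong (lookup (trace x w)) (next-fromℕ n) ⟩
  x                                                            ≡⟨ closed ⟨
  applySwaps x w                                               ≡⟨ lookup-trace-last x w ⟨
  swapAdjVec (lookup w (fromℕ n)) (lookup (trace x w) (fromℕ n)) ∎
... | ‵inject₁ j′ = trans (cong (lookup (trace x w)) (next-inject₁ j′)) (lookup-trace-suc x w j′)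

closedWalk⇒rainbowCycle : (x : Vec (Fin (suc k)) (suc k)) (w : Vec (Fin k) n) → Unique x →
                          applySwaps x w ≡ x → Unique (trace x w) → (∀ i → count (_≟ i) w ≡ r) →
                          RainbowCycle r k
closedWalk⇒rainbowCycle {k = k} {n = n} x w x-unique closed simple rainbow = record
  { L        = n
  ; perm     = vertex
  ; colour   = lookup w
  ; distinct = λ eq → Unique.lookup-injective simple _ _ (cong proj₁ eq)
  ; steps    = lookup-trace-next x w closed
  ; rainbow  = λ i → trans (sym (count-map (_≟ i) (lookup w) (allFin n)))
                           (trans (cong (count (_≟ i)) (map-lookup-allFin w)) (rainbow i))
  }
  where
  vertex : Fin n → Perm (suc k)
  vertex j = lookup (trace x w) j , lookup⁺ (trace-unique x w x-unique) j

module WalkMap {A B : Set} {k l : ℕ}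
  (Λ : Vec A (suc k) → Vec B (suc l)) (σ : Fin k → Fin l)
  (Λ-swap : ∀ i x → Λ (swapAdjVec i x) ≡ swapAdjVec (σ i) (Λ x)) where

  applySwaps-map : (x : Vec A (suc k)) (w : Vec (Fin k) n) →
                   applySwaps (Λ x) (map σ w) ≡ Λ (applySwaps x w)
  applySwaps-map x []      = refl
  applySwaps-map x (i ∷ w) =
    trans (cong (λ y → applySwaps y (map σ w)) (sym (Λ-swap i x)))
          (applySwaps-map (swapAdjVec i x) w)

  trace-map : (x : Vec A (suc k)) (w : Vec (Fin k) n) → trace (Λ x) (map σ w) ≡ map Λ (trace x w)
  trace-map x []      = refl
  trace-map x (i ∷ w) =
    cong (Λ x ∷_) (trans (cong (λ y → trace y (map σ w)) (sym (Λ-swap i x)))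
                         (trace-map (swapAdjVec i x) w))

extend : Vec (Fin k) n → Vec (Fin (suc k)) (suc n)
extend x = zero ∷ map suc x

extend-injective : Injective _≡_ _≡_ (extend {k} {n})
extend-injective eq = map-injective suc-injective (∷-injectiveʳ eq)

extend-unique : {x : Vec (Fin k) n} → Unique x → Unique (extend x)
extend-unique {x = x} u = map⁺ (universal (λ _ ()) x) ∷ Unique.map⁺ suc-injective u

extend-swap : (i : Fin n) (x : Vec (Fin k) (suc n)) →
              extend (swapAdjVec i x) ≡ swapAdjVec (suc i) (extend x)
extend-swap i x = cong (zero ∷_) (sym (swapAdjVec-map suc i x))

extend² : Vec (Fin k) n → Vec (Fin (2 + k)) (2 + n)
extend² = extend ∘ extend

extend²-swap : (i : Fin n) (x : Vec (Fin k) (suc n)) →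
               extend² (swapAdjVec i x) ≡ swapAdjVec (suc (suc i)) (extend² x)
extend²-swap i x = trans (cong extend (extend-swap i x)) (extend-swap (suc i) (extend x))

-- Replace the edge a → swapAdjVec d a of a cycle by a detour e ∷ u from Λ a to
-- Λ (swapAdjVec d a) avoiding the image of Λ; the new cycle starts after e.
module Detour {A B : Set} {k l : ℕ}
  (Λ : Vec A (suc k) → Vec B (suc l)) (Λ-injective : Injective _≡_ _≡_ Λ)
  (σ : Fin k → Fin l) (σ-injective : Injective _≡_ _≡_ σ)
  (Λ-swap : ∀ i x → Λ (swapAdjVec i x) ≡ swapAdjVec (σ i) (Λ x))
  {n p : ℕ} (a : Vec A (suc k)) (d : Fin k) (cs : Vec (Fin k) n) (e : Fin l) (u : Vec (Fin l) p)
  where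

  open WalkMap Λ σ Λ-swap

  start : Vec B (suc l)
  start = swapAdjVec e (Λ a)

  word : Vec (Fin l) (p + (n + 1))
  word = u ++ map σ cs ++ [ e ]

  module _ (closed : applySwaps a (d ∷ cs) ≡ a)
           (detour-ends : applySwaps start u ≡ swapAdjVec (σ d) (Λ a)) where

    private
      b : Vec A (suc k)
      b = swapAdjVec d a

      reaches-Λb : applySwaps start u ≡ Λ b
      reaches-Λb = trans detour-ends (sym (Λ-swap d a))

    word-closed : applySwaps start word ≡ start
    word-closed = begin
      applySwaps start word
        ≡⟨ applySwaps-++ start u _ ⟩
      applySwaps (applySwaps start u) (map σ cs ++ [ e ])
        ≡⟨ cong (λ y → applySwaps y (map σ cs ++ [ e ])) reaches-Λb ⟩
      applySwaps (Λ b) (map σ cs ++ [ e ])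
        ≡⟨ applySwaps-++ (Λ b) (map σ cs) [ e ] ⟩
      swapAdjVec e (applySwaps (Λ b) (map σ cs))
        ≡⟨ cong (swapAdjVec e) (applySwaps-map b cs) ⟩
      swapAdjVec e (Λ (applySwaps b cs))
        ≡⟨ cong (swapAdjVec e ∘ Λ) closed ⟩
      start
        ∎

    word-trace : trace start word ≡ trace start u ++ map Λ (trace b cs ++ [ a ])
    word-trace = begin
      trace start word
        ≡⟨ trace-++ start u _ ⟩
      trace start u ++ trace (applySwaps start u) (map σ cs ++ [ e ])
        ≡⟨ cong (λ y → trace start u ++ trace y (map σ cs ++ [ e ])) reaches-Λb ⟩
      trace start u ++ trace (Λ b) (map σ cs ++ [ e ])
        ≡⟨ cong (trace start u ++_) (trace-++ (Λ b) (map σ cs) [ e ]) ⟩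
      trace start u ++ trace (Λ b) (map σ cs) ++ [ applySwaps (Λ b) (map σ cs) ]
        ≡⟨ cong (λ y → trace start u ++ trace (Λ b) (map σ cs) ++ [ y ])
                (trans (applySwaps-map b cs) (cong Λ closed)) ⟩
      trace start u ++ trace (Λ b) (map σ cs) ++ [ Λ a ]
        ≡⟨ cong (λ y → trace start u ++ y ++ [ Λ a ]) (trace-map b cs) ⟩
      trace start u ++ map Λ (trace b cs) ++ [ Λ a ]
        ≡⟨ cong (trace start u ++_) (map-++ Λ (trace b cs) [ a ]) ⟨
      trace start u ++ map Λ (trace b cs ++ [ a ])
        ∎

    word-simple : Unique (trace a (d ∷ cs)) → Unique (trace start u) →
                  All (λ v → ∀ z → v ≢ Λ z) (trace start u) → Unique (trace start word)
    word-simple simple detour-simple outside =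
      subst Unique (sym word-trace)
            (Unique-++-map Λ-injective detour-simple (Unique-rotate simple) outside)

  word-count : ∀ i → count (_≟ i) word ≡ count (_≟ i) (u ++ [ e ]) + count (_≟ i) (map σ cs)
  word-count i = begin
    count (_≟ i) (u ++ map σ cs ++ [ e ])     ≡⟨ count-++ (_≟ i) u _ ⟩
    cu + count (_≟ i) (map σ cs ++ [ e ])     ≡⟨ cong (cu +_) (count-++ (_≟ i) (map σ cs) [ e ]) ⟩
    cu + (cm + ce)                            ≡⟨ cong (cu +_) (+-comm cm ce) ⟩
    cu + (ce + cm)                            ≡⟨ +-assoc cu ce cm ⟨
    cu + ce + cm                              ≡⟨ cong (_+ cm) (count-++ (_≟ i) u [ e ]) ⟨
    count (_≟ i) (u ++ [ e ]) + cm            ∎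
    where
    cu cm ce : ℕ
    cu = count (_≟ i) u
    cm = count (_≟ i) (map σ cs)
    ce = count (_≟ i) [ e ]

  word-count-lifted : ∀ j → count (_≟ σ j) (u ++ [ e ]) ≡ count (_≟ j) [ d ] →
                      count (_≟ σ j) word ≡ count (_≟ j) (d ∷ cs)
  word-count-lifted j detour-count = begin
    count (_≟ σ j) word
      ≡⟨ word-count (σ j) ⟩
    count (_≟ σ j) (u ++ [ e ]) + count (_≟ σ j) (map σ cs)
      ≡⟨ cong₂ _+_ detour-count (count-map-injective σ-injective j cs) ⟩
    count (_≟ j) [ d ] + count (_≟ j) cs
      ≡⟨ count-++ (_≟ j) [ d ] cs ⟨
    count (_≟ j) (d ∷ cs)
      ∎

  word-count-new : ∀ i → (∀ x → σ x ≢ i) → count (_≟ i) word ≡ count (_≟ i) (u ++ [ e ])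
  word-count-new i i∉σ =
    trans (word-count i) (trans (cong (_ +_) (count-map-∉ i∉σ cs)) (+-identityʳ _))

-- An r-rainbow cycle in P^adj_{m+2} whose first step leaves the first entry in
-- place: that edge is the one the detours below replace.
record LiftableCycle (r m : ℕ) : Set where
  field
    {len}        : ℕ
    start        : Vec (Fin (2 + m)) (2 + m)
    start-unique : Unique start
    first        : Fin m
    rest         : Vec (Fin (suc m)) len
    closed       : applySwaps start (suc first ∷ rest) ≡ start
    simple       : Unique (trace start (suc first ∷ rest))
    rainbow      : ∀ i → count (_≟ i) (suc first ∷ rest) ≡ r

-- Matching the start against _ ∷ _ lets the detour vertices compute, so the
-- local facts about the detour hold by refl and by λ ().
grow-2-rainbow : LiftableCycle 2 m → LiftableCycle 2 (suc m)
grow-2-rainbow C@record { start = _ ∷ _ } = record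
  { start        = D.start
  ; start-unique = start-unique′
  ; first        = suc first
  ; rest         = tail D.word
  ; closed       = D.word-closed closed refl
  ; simple       = D.word-simple closed refl simple detour-simple ((λ _ ()) ∷ (λ _ ()) ∷ [])
  ; rainbow      = λ { zero    → D.word-count-new zero (λ _ ())
                     ; (suc j) → trans (D.word-count-lifted j refl) (rainbow j) }
  }
  where
  open LiftableCycle C
  module D = Detour extend extend-injective suc suc-injective extend-swap
                    start (suc first) rest zero (suc (suc first) ∷ zero ∷ [])
  start-unique′ : Unique D.start
  start-unique′ = swapAdjVec-unique zero (extend-unique start-unique)
  detour-simple : Unique (trace D.start (suc (suc first) ∷ zero ∷ []))
  detour-simple = (swapAdjVec-≢ (suc (suc first)) start-unique′ ∷ []) ∷ [] ∷ []

grow-3-rainbow : LiftableCycle 3 m → LiftableCycle 3 (2 + m)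
grow-3-rainbow {m = m} C@record { start = _ ∷ _ } = record
  { start        = D.start
  ; start-unique = start-unique′
  ; first        = zero
  ; rest         = tail D.word
  ; closed       = D.word-closed closed refl
  ; simple       = D.word-simple closed refl simple detour-simple
                     ((λ _ ()) ∷ (λ _ ()) ∷ (λ _ ()) ∷ (λ _ ()) ∷ (λ _ ()) ∷ (λ _ ()) ∷ [])
  ; rainbow      = λ { zero          → D.word-count-new zero (λ _ ())
                     ; (suc zero)    → D.word-count-new (suc zero) (λ _ ())
                     ; (suc (suc j)) → trans (D.word-count-lifted j refl) (rainbow j) }
  }
  where
  open LiftableCycle C
  d′ : Fin (3 + m)
  d′ = suc (suc (suc first))
  detour : Vec (Fin (3 + m)) 6
  detour = suc zero ∷ zero ∷ d′ ∷ suc zero ∷ zero ∷ suc zero ∷ []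
  module D = Detour extend² (extend-injective ∘ extend-injective)
                    (λ i → suc (suc i)) (suc-injective ∘ suc-injective) extend²-swap
                    start (suc first) rest zero detour
  start-unique′ : Unique D.start
  start-unique′ = swapAdjVec-unique zero (extend-unique (extend-unique start-unique))
  third-unique : Unique (swapAdjVec zero (swapAdjVec (suc zero) D.start))
  third-unique = swapAdjVec-unique zero (swapAdjVec-unique (suc zero) start-unique′)
  detour-simple : Unique (trace D.start detour)
  detour-simple = ((λ ()) ∷ (λ ()) ∷ (λ ()) ∷ (λ ()) ∷ (λ ()) ∷ [])
                ∷ ((λ ()) ∷ (λ ()) ∷ (λ ()) ∷ (λ ()) ∷ [])
                ∷ (swapAdjVec-≢ d′ third-unique ∷ (λ ()) ∷ (λ ()) ∷ [])
                ∷ ((λ ()) ∷ (λ ()) ∷ [])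
                ∷ ((λ ()) ∷ [])
                ∷ [] ∷ []

toRainbowCycle : LiftableCycle r m → RainbowCycle r (suc m)
toRainbowCycle C =
  closedWalk⇒rainbowCycle start (suc first ∷ rest) start-unique closed simple rainbow
  where open LiftableCycle C

base-2-rainbow : LiftableCycle 2 3
base-2-rainbow = record
  { start        = allFin 5
  ; start-unique = from-yes (unique? _≟_ (allFin 5))
  ; first        = zero
  ; rest         = rest
  ; closed       = refl
  ; simple       = from-yes (unique? (≡-dec _≟_) (trace (allFin 5) (suc zero ∷ rest)))
  ; rainbow      = λ { zero → refl ; (suc zero) → refl ; (suc (suc zero)) → refl
                     ; (suc (suc (suc zero))) → refl }
  }
  where
  rest : Vec (Fin 4) 7
  rest = # 0 ∷ # 3 ∷ # 2 ∷ # 0 ∷ # 2 ∷ # 1 ∷ # 3 ∷ []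

base-3-rainbow : LiftableCycle 3 1
base-3-rainbow = record
  { start        = allFin 3
  ; start-unique = from-yes (unique? _≟_ (allFin 3))
  ; first        = zero
  ; rest         = rest
  ; closed       = refl
  ; simple       = from-yes (unique? (≡-dec _≟_) (trace (allFin 3) (suc zero ∷ rest)))
  ; rainbow      = λ { zero → refl ; (suc zero) → refl }
  }
  where
  rest : Vec (Fin 2) 5
  rest = # 0 ∷ # 1 ∷ # 0 ∷ # 1 ∷ # 0 ∷ []

two-rainbow : ∀ k → LiftableCycle 2 (3 + k)
two-rainbow zero    = base-2-rainbow
two-rainbow (suc k) = grow-2-rainbow (two-rainbow k)

-- Indexed by k * 2, not 2 * k, so that the index at suc k reduces to 2 + the one at k.
three-rainbow : ∀ k → LiftableCycle 3 (1 + k * 2)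
three-rainbow zero    = base-3-rainbow
three-rainbow (suc k) = grow-3-rainbow (three-rainbow k)

theorem2p4 : ((n : ℕ) → 5 ≤ n → HasRainbowCycle 2 n)
             × ((k : ℕ) → HasRainbowCycle 3 (2 * k + 3))
theorem2p4 = from-five , odd
  where
  from-five : (n : ℕ) → 5 ≤ n → HasRainbowCycle 2 n
  from-five _ (s≤s (s≤s (s≤s (s≤s (s≤s (z≤n {k})))))) = toRainbowCycle (two-rainbow k)
  odd : (k : ℕ) → HasRainbowCycle 3 (2 * k + 3)
  odd k = subst (HasRainbowCycle 3) (trans (+-comm 3 (k * 2)) (cong (_+ 3) (*-comm k 2)))
                (toRainbowCycle (three-rainbow k))
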